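{- Let $F_j$ be the Fibonacci numbers ($F_1=F_2=1$) and $I_n(x)=\prod_{i=1}^n\left(1+x^{F_{i+1}}\right)=\sum_k c_n(k)x^k$ for $n\ge0$. For integers $m\ge1$ and $0\le a<m$, let $h_{m,a}(n)$ be the number of integers $0\le k\le\deg I_n(x)$ with $c_n(k)\equiv a\pmod m$. Then $H_{m,a}(x)=\sum_{n\ge0}h_{m,a}(n)x^n$ is a rational function of $x$. -}

module Defs where

open import Data.Nat using (ℕ; zero; suc; _+_; _≤_; NonZero; _≟_)
open import Data.Nat.DivMod using (_%_)
open import Data.Integer as ℤ using (ℤ)
open import Data.List using (List; []; _∷_; _++_; replicate; filter; length)
open import Data.List.Relation.Unary.Any using (Any)
open import Data.Product using (∃; _×_)
open import Relation.Binary.PropositionalEquality using (_≡_; _≢_)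

F : ℕ → ℕ
F zero = 0
F (suc zero) = 1
F (suc (suc n)) = F n + F (suc n)

-- Polynomials with ℕ coefficients as coefficient lists (constant term first).
addP : List ℕ → List ℕ → List ℕ
addP [] q = q
addP p [] = p
addP (a ∷ p) (b ∷ q) = (a + b) ∷ addP p q

mulOnePlusXPow : ℕ → List ℕ → List ℕ
mulOnePlusXPow k p = addP p (replicate k 0 ++ p)

-- I n = ∏_{i=1}^{n} (1 + x^{F (i+1)}); its coefficient list has length deg I_n + 1
-- (leading coefficient 1), so its entries are exactly c_n(0), …, c_n(deg I_n).
I : ℕ → List ℕ
I zero = 1 ∷ []
I (suc n) = mulOnePlusXPow (F (suc (suc n))) (I n)

h : (m : ℕ) → .{{_ : NonZero m}} → ℕ → ℕ → ℕ
h m a n = length (filter (λ c → c % m ≟ a) (I n))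

-- Coefficient of x^n in Q(x) · H(x), where Q is a polynomial (coefficient list)
-- and H(x) = Σ_n s(n) x^n is a formal power series.
mulCoeff : List ℤ → (ℕ → ℤ) → ℕ → ℤ
mulCoeff [] s n = ℤ.+ 0
mulCoeff (q ∷ qs) s zero = q ℤ.* s zero
mulCoeff (q ∷ qs) s (suc n) = q ℤ.* s (suc n) ℤ.+ mulCoeff qs s n

-- The power series Σ s(n) xⁿ is a rational function: there is a nonzero
-- polynomial Q with Q·H a polynomial (coefficients vanish from some index on).
-- (Integer Q suffices: rational coefficients can be cleared of denominators.)
IsRationalSeries : (ℕ → ℤ) → Set
IsRationalSeries s =
  ∃ λ (Q : List ℤ) → Any (λ q → q ≢ ℤ.+ 0) Q ×
    ∃ λ (N : ℕ) → ∀ n → N ≤ n → mulCoeff Q s n ≡ ℤ.+ 0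

-- Write I_n = A_{n+1} ++ [1] ++ B_n, where A_j and B_j are words of length F_{j+1} − 1 with
-- A_{j+2} = A_{j+1} ++ [1] ++ C_j,  B_{j+2} = C_j ++ [1] ++ B_{j+1},  C_j = A_j + B_j (entrywise).
-- Let N_j(α, β) count the entries of αA_j + βB_j that are ≡ a (mod m). It only depends on α and β
-- modulo m, and unfolding the recursion three times gives
--   N_{j+3}(α, β) = N_{j+1}(α+β, β) + N_j(α+β, α+β) + N_{j+1}(α, α+β) + 2·[α+β ≡ a],
-- while h_{m,a}(n) = N_{n+1}(1, 0) + [1 ≡ a] + N_n(0, 1). So the vectors of all values N_j, N_{j+1},
-- N_{j+2} (over residues α, β), together with a constant 1, form the orbit of a fixed integer matrix
-- on ℤ^X for a finite X. Any |X| + 1 of them are linearly dependent (Gaussian elimination over ℤ);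
-- the dependence propagates along the orbit and yields a linear recurrence with constant
-- coefficients for h_{m,a}, i.e. a denominator for H_{m,a}.
module Submission where

open import Defs
open import Data.Nat as ℕ using (ℕ; zero; suc; _<_; _≤_; NonZero)
import Data.Nat.Properties as ℕ
open import Data.Integer using (ℤ; +_; 0ℤ; 1ℤ)
open import Data.List using (List; []; _∷_; [_]; _++_; length; map)
open import Data.List.Properties using (length-++; length-map; ++-assoc; map-++)
open import Data.List.Membership.Propositional using (_∈_)
open import Data.Product using (_×_; _,_)
open import Relation.Nullary using (yes; no)
open import Relation.Binary.PropositionalEquality hiding ([_])
open ≡-Reasoning

length-++-∷ : ∀ {A : Set} (xs : List A) {y ys} → length (xs ++ y ∷ ys) ≡ suc (length xs ℕ.+ length ys)
length-++-∷ xs {ys = ys} = trans (length-++ xs) (ℕ.+-suc (length xs) (length ys))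

module FibonacciWords where
  open import Data.Nat using (_+_; _⊓_; pred)
  open import Data.Nat.Properties using (+-identityʳ; +-comm; ⊓-idem)
  open import Data.List using (replicate; zipWith)
  open import Data.List.Properties using (length-zipWith)

  infixr 6 _⊕_

  _⊕_ : List ℕ → List ℕ → List ℕ
  _⊕_ = zipWith _+_

  mutual
    A : ℕ → List ℕ
    A zero = []
    A (suc zero) = []
    A (suc (suc j)) = A (suc j) ++ 1 ∷ C j

    B : ℕ → List ℕ
    B zero = []
    B (suc zero) = []
    B (suc (suc j)) = C j ++ 1 ∷ B (suc j)

    C : ℕ → List ℕ
    C j = B j ⊕ A j

  length-⊕ : ∀ xs ys → length xs ≡ length ys → length (xs ⊕ ys) ≡ length ys
  length-⊕ xs ys eq = trans (length-zipWith _+_ xs ys) (trans (cong (_⊓ length ys) eq) (⊓-idem _))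

  length-A≡length-B : ∀ j → length (A j) ≡ length (B j)
  length-A≡length-B zero = refl
  length-A≡length-B (suc zero) = refl
  length-A≡length-B (suc (suc j)) = begin
    length (A (suc j) ++ 1 ∷ C j)            ≡⟨ length-++-∷ (A (suc j)) ⟩
    suc (length (A (suc j)) + length (C j))  ≡⟨ cong suc (+-comm (length (A (suc j))) _) ⟩
    suc (length (C j) + length (A (suc j)))  ≡⟨ cong (λ n → suc (length (C j) + n)) (length-A≡length-B (suc j)) ⟩
    suc (length (C j) + length (B (suc j)))  ≡⟨ length-++-∷ (C j) ⟨
    length (C j ++ 1 ∷ B (suc j))            ∎

  length-C : ∀ j → length (C j) ≡ length (A j)
  length-C j = length-⊕ (B j) (A j) (sym (length-A≡length-B j))

  suc-length-A : ∀ j → suc (length (A j)) ≡ F (suc j)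
  suc-length-A zero = refl
  suc-length-A (suc zero) = refl
  suc-length-A (suc (suc j)) = begin
    suc (length (A (suc j) ++ 1 ∷ C j))             ≡⟨ cong suc (length-++-∷ (A (suc j))) ⟩
    suc (suc (length (A (suc j)) + length (C j)))   ≡⟨ cong (λ n → suc (suc (length (A (suc j)) + n))) (length-C j) ⟩
    suc (suc (length (A (suc j)) + length (A j)))   ≡⟨ cong suc (+-comm (suc (length (A (suc j)))) (length (A j))) ⟩
    suc (length (A j) + suc (length (A (suc j))))   ≡⟨ cong₂ _+_ (suc-length-A j) (suc-length-A (suc j)) ⟩
    F (suc j) + F (suc (suc j))                     ∎

  addP-shifted : ∀ xs y ys zs →
    addP (xs ++ y ∷ ys) (replicate (suc (length xs)) 0 ++ zs) ≡ xs ++ y ∷ addP ys zs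
  addP-shifted [] y ys zs = cong (_∷ addP ys zs) (+-identityʳ y)
  addP-shifted (x ∷ xs) y ys zs = cong₂ _∷_ (+-identityʳ x) (addP-shifted xs y ys zs)

  addP-++ : ∀ {xs ys} zs → length xs ≡ length ys → addP xs (ys ++ zs) ≡ (xs ⊕ ys) ++ zs
  addP-++ {[]} {[]} zs _ = refl
  addP-++ {x ∷ xs} {y ∷ ys} zs eq = cong (x + y ∷_) (addP-++ zs (cong pred eq))

  A++1∷B-shift : ∀ j → A (suc (suc j)) ++ 1 ∷ B (suc j) ≡ A (suc j) ++ 1 ∷ B (suc (suc j))
  A++1∷B-shift j = ++-assoc (A (suc j)) (1 ∷ C j) (1 ∷ B (suc j))

  addP-B-A++1∷B : ∀ j → addP (B j) (A (suc j) ++ 1 ∷ B j) ≡ C j ++ 1 ∷ B (suc j)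
  addP-B-A++1∷B zero = refl
  addP-B-A++1∷B (suc j) = begin
    addP (B (suc j)) (A (suc (suc j)) ++ 1 ∷ B (suc j))  ≡⟨ cong (addP (B (suc j))) (A++1∷B-shift j) ⟩
    addP (B (suc j)) (A (suc j) ++ 1 ∷ B (suc (suc j)))  ≡⟨ addP-++ (1 ∷ B (suc (suc j))) (sym (length-A≡length-B (suc j))) ⟩
    C (suc j) ++ 1 ∷ B (suc (suc j))                      ∎

  I≡A++1∷B : ∀ n → I n ≡ A (suc n) ++ 1 ∷ B n
  I≡A++1∷B zero = refl
  I≡A++1∷B (suc n) = begin
    addP (I n) (replicate (F (suc (suc n))) 0 ++ I n)
      ≡⟨ cong (λ w → addP w (replicate (F (suc (suc n))) 0 ++ w)) (I≡A++1∷B n) ⟩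
    addP (A′ ++ 1 ∷ B n) (replicate (F (suc (suc n))) 0 ++ A′ ++ 1 ∷ B n)
      ≡⟨ cong (λ k → addP (A′ ++ 1 ∷ B n) (replicate k 0 ++ A′ ++ 1 ∷ B n)) (suc-length-A (suc n)) ⟨
    addP (A′ ++ 1 ∷ B n) (replicate (suc (length A′)) 0 ++ A′ ++ 1 ∷ B n)
      ≡⟨ addP-shifted A′ 1 (B n) (A′ ++ 1 ∷ B n) ⟩
    A′ ++ 1 ∷ addP (B n) (A′ ++ 1 ∷ B n)
      ≡⟨ cong (λ w → A′ ++ 1 ∷ w) (addP-B-A++1∷B n) ⟩
    A′ ++ 1 ∷ C n ++ 1 ∷ B (suc n)
      ≡⟨ A++1∷B-shift n ⟨
    A (suc (suc n)) ++ 1 ∷ B (suc n)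
      ∎
    where A′ = A (suc n)

module ResidueCount (m : ℕ) .{{_ : NonZero m}} (a : ℕ) where
  open FibonacciWords
  open import Data.Nat using (_+_; _*_; _≟_; pred)
  open import Data.Nat.Properties using (+-identityʳ)
  open import Data.Nat.DivMod using (_%_; %-distribˡ-+; %-distribˡ-*)
  open import Data.Nat.Tactic.RingSolver using (solve-∀)
  open import Data.List using (zipWith; filter)
  open import Data.List.Properties using (filter-++; filter-accept; filter-reject)
  open import Data.List.Relation.Binary.Pointwise using (Pointwise; []; _∷_)
  open import Relation.Nullary using (Dec)

  residue≟a : (c : ℕ) → Dec (c % m ≡ a)
  residue≟a c = c % m ≟ a

  count : List ℕ → ℕ
  count xs = length (filter residue≟a xs)

  count-++ : ∀ xs ys → count (xs ++ ys) ≡ count xs + count ys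
  count-++ xs ys = trans (cong length (filter-++ residue≟a xs ys)) (length-++ (filter residue≟a xs))

  infix 4 _≡ₘ_

  _≡ₘ_ : ℕ → ℕ → Set
  x ≡ₘ y = x % m ≡ y % m

  count-cong : ∀ {xs ys} → Pointwise _≡ₘ_ xs ys → count xs ≡ count ys
  count-cong [] = refl
  count-cong {x ∷ xs} {y ∷ ys} (x≡y ∷ xs≡ys) with y % m ≟ a
  ... | yes y≡a = begin
    count (x ∷ xs)  ≡⟨ cong length (filter-accept residue≟a (trans x≡y y≡a)) ⟩
    suc (count xs)  ≡⟨ cong suc (count-cong xs≡ys) ⟩
    suc (count ys)  ≡⟨ cong length (filter-accept residue≟a y≡a) ⟨
    count (y ∷ ys)  ∎
  ... | no y≢a = begin
    count (x ∷ xs)  ≡⟨ cong length (filter-reject residue≟a (λ x≡a → y≢a (trans (sym x≡y) x≡a))) ⟩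
    count xs        ≡⟨ count-cong xs≡ys ⟩
    count ys        ≡⟨ cong length (filter-reject residue≟a y≢a) ⟨
    count (y ∷ ys)  ∎

  *-+-congₘ : ∀ {α α′ β β′} x y → α ≡ₘ α′ → β ≡ₘ β′ → (α * x + β * y) ≡ₘ (α′ * x + β′ * y)
  *-+-congₘ {α} {α′} {β} {β′} x y α≡α′ β≡β′ = begin
    (α * x + β * y) % m                ≡⟨ %-distribˡ-+ (α * x) (β * y) m ⟩
    ((α * x) % m + (β * y) % m) % m    ≡⟨ cong₂ (λ p q → (p + q) % m) (*-congₘ α≡α′) (*-congₘ β≡β′) ⟩
    ((α′ * x) % m + (β′ * y) % m) % m  ≡⟨ %-distribˡ-+ (α′ * x) (β′ * y) m ⟨
    (α′ * x + β′ * y) % m              ∎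
    where
    *-congₘ : ∀ {u v z} → u ≡ₘ v → (u * z) ≡ₘ (v * z)
    *-congₘ {u} {v} {z} u≡v = trans (%-distribˡ-* u z m) (trans (cong (λ w → (w * (z % m)) % m) u≡v) (sym (%-distribˡ-* v z m)))

  combine : ℕ → ℕ → List ℕ → List ℕ → List ℕ
  combine α β = zipWith (λ x y → α * x + β * y)

  combine-congₘ : ∀ {α α′ β β′} xs ys → α ≡ₘ α′ → β ≡ₘ β′ →
    Pointwise _≡ₘ_ (combine α β xs ys) (combine α′ β′ xs ys)
  combine-congₘ [] _ _ _ = []
  combine-congₘ (_ ∷ _) [] _ _ = []
  combine-congₘ (x ∷ xs) (y ∷ ys) α≡α′ β≡β′ = *-+-congₘ x y α≡α′ β≡β′ ∷ combine-congₘ xs ys α≡α′ β≡β′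

  combine-++ : ∀ α β xs ys xs′ ys′ → length xs ≡ length ys →
    combine α β (xs ++ xs′) (ys ++ ys′) ≡ combine α β xs ys ++ combine α β xs′ ys′
  combine-++ α β [] [] xs′ ys′ _ = refl
  combine-++ α β (x ∷ xs) (y ∷ ys) xs′ ys′ eq = cong (α * x + β * y ∷_) (combine-++ α β xs ys xs′ ys′ (cong pred eq))

  module _ (α β : ℕ) where

    combine-x-⊕ : ∀ xs ys → combine α β xs (ys ⊕ xs) ≡ combine (α + β) β xs ys
    combine-x-⊕ [] _ = refl
    combine-x-⊕ (_ ∷ _) [] = refl
    combine-x-⊕ (x ∷ xs) (y ∷ ys) = cong₂ _∷_ (pointwise α β x y) (combine-x-⊕ xs ys)
      where
      pointwise : ∀ p q x y → p * x + q * (y + x) ≡ (p + q) * x + q * y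
      pointwise = solve-∀

    combine-⊕-⊕ : ∀ xs ys → combine α β (ys ⊕ xs) (ys ⊕ xs) ≡ combine (α + β) (α + β) xs ys
    combine-⊕-⊕ [] [] = refl
    combine-⊕-⊕ [] (_ ∷ _) = refl
    combine-⊕-⊕ (_ ∷ _) [] = refl
    combine-⊕-⊕ (x ∷ xs) (y ∷ ys) = cong₂ _∷_ (pointwise α β x y) (combine-⊕-⊕ xs ys)
      where
      pointwise : ∀ p q x y → p * (y + x) + q * (y + x) ≡ (p + q) * x + (p + q) * y
      pointwise = solve-∀

    combine-⊕-y : ∀ xs ys → combine α β (ys ⊕ xs) ys ≡ combine α (α + β) xs ys
    combine-⊕-y [] [] = refl
    combine-⊕-y [] (_ ∷ _) = refl
    combine-⊕-y (_ ∷ _) [] = refl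
    combine-⊕-y (x ∷ xs) (y ∷ ys) = cong₂ _∷_ (pointwise α β x y) (combine-⊕-y xs ys)
      where
      pointwise : ∀ p q x y → p * (y + x) + q * y ≡ p * x + (p + q) * y
      pointwise = solve-∀

  N : ℕ → ℕ → ℕ → ℕ
  N j α β = count (combine α β (A j) (B j))

  N-congₘ : ∀ j {α α′ β β′} → α ≡ₘ α′ → β ≡ₘ β′ → N j α β ≡ N j α′ β′
  N-congₘ j α≡α′ β≡β′ = count-cong (combine-congₘ (A j) (B j) α≡α′ β≡β′)

  combine-A-B-unfold : ∀ α β j → let σ = α * 1 + β * 1 in
    combine α β (A (3 + j)) (B (3 + j)) ≡
    combine α β (A (suc j)) (C (suc j)) ++ σ ∷ combine α β (C j) (C j) ++ σ ∷ combine α β (C (suc j)) (B (suc j))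
  combine-A-B-unfold α β j = begin
    combine α β ((A (suc j) ++ 1 ∷ C j) ++ 1 ∷ C (suc j)) (C (suc j) ++ 1 ∷ C j ++ 1 ∷ B (suc j))
      ≡⟨ cong (λ xs → combine α β xs (C (suc j) ++ 1 ∷ C j ++ 1 ∷ B (suc j))) (++-assoc (A (suc j)) _ _) ⟩
    combine α β (A (suc j) ++ 1 ∷ C j ++ 1 ∷ C (suc j)) (C (suc j) ++ 1 ∷ C j ++ 1 ∷ B (suc j))
      ≡⟨ combine-++ α β (A (suc j)) (C (suc j)) _ _ (sym (length-C (suc j))) ⟩
    combine α β (A (suc j)) (C (suc j)) ++ combine α β (1 ∷ C j ++ 1 ∷ C (suc j)) (1 ∷ C j ++ 1 ∷ B (suc j))
      ≡⟨ cong (λ zs → combine α β (A (suc j)) (C (suc j)) ++ α * 1 + β * 1 ∷ zs) (combine-++ α β (C j) (C j) _ _ refl) ⟩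
    combine α β (A (suc j)) (C (suc j)) ++ α * 1 + β * 1 ∷ combine α β (C j) (C j) ++ combine α β (1 ∷ C (suc j)) (1 ∷ B (suc j))
      ∎

  N-recurrence : ∀ j α β → let s = count [ α * 1 + β * 1 ] in
    N (3 + j) α β ≡ N (suc j) (α + β) β + N j (α + β) (α + β) + N (suc j) α (α + β) + (s + s)
  N-recurrence j α β = begin
    count (combine α β (A (3 + j)) (B (3 + j)))
      ≡⟨ cong count (combine-A-B-unfold α β j) ⟩
    count (X ++ σ ∷ Y ++ σ ∷ Z)
      ≡⟨ count-++ X _ ⟩
    count X + count (σ ∷ Y ++ σ ∷ Z)
      ≡⟨ cong (_+_ (count X)) (count-++ [ σ ] _) ⟩
    count X + (s + count (Y ++ σ ∷ Z))
      ≡⟨ cong (λ n → count X + (s + n)) (count-++ Y _) ⟩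
    count X + (s + (count Y + count (σ ∷ Z)))
      ≡⟨ cong (λ n → count X + (s + (count Y + n))) (count-++ [ σ ] Z) ⟩
    count X + (s + (count Y + (s + count Z)))
      ≡⟨ rearrange (count X) s (count Y) (count Z) ⟩
    count X + count Y + count Z + (s + s)
      ≡⟨ cong₂ (λ p q → count p + count q + count Z + (s + s))
           (combine-x-⊕ α β (A (suc j)) (B (suc j))) (combine-⊕-⊕ α β (A j) (B j)) ⟩
    N (suc j) (α + β) β + N j (α + β) (α + β) + count Z + (s + s)
      ≡⟨ cong (λ p → N (suc j) (α + β) β + N j (α + β) (α + β) + count p + (s + s))
           (combine-⊕-y α β (A (suc j)) (B (suc j))) ⟩
    N (suc j) (α + β) β + N j (α + β) (α + β) + N (suc j) α (α + β) + (s + s)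
      ∎
    where
    σ = α * 1 + β * 1
    s = count [ σ ]
    X = combine α β (A (suc j)) (C (suc j))
    Y = combine α β (C j) (C j)
    Z = combine α β (C (suc j)) (B (suc j))
    rearrange : ∀ x s y z → x + (s + (y + (s + z))) ≡ x + y + z + (s + s)
    rearrange = solve-∀

  combine-1-0 : ∀ xs ys → length xs ≡ length ys → combine 1 0 xs ys ≡ xs
  combine-1-0 [] [] _ = refl
  combine-1-0 (x ∷ xs) (y ∷ ys) eq = cong₂ _∷_ (trans (+-identityʳ (x + 0)) (+-identityʳ x)) (combine-1-0 xs ys (cong pred eq))

  combine-0-1 : ∀ xs ys → length xs ≡ length ys → combine 0 1 xs ys ≡ ys
  combine-0-1 [] [] _ = refl
  combine-0-1 (x ∷ xs) (y ∷ ys) eq = cong₂ _∷_ (+-identityʳ y) (combine-0-1 xs ys (cong pred eq))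

  h≡N : ∀ n → h m a n ≡ N (suc n) 1 0 + (count [ 1 ] + N n 0 1)
  h≡N n = begin
    count (I n)                                          ≡⟨ cong count (I≡A++1∷B n) ⟩
    count (A (suc n) ++ 1 ∷ B n)                         ≡⟨ count-++ (A (suc n)) _ ⟩
    count (A (suc n)) + count (1 ∷ B n)                  ≡⟨ cong (_+_ (count (A (suc n)))) (count-++ [ 1 ] (B n)) ⟩
    count (A (suc n)) + (count [ 1 ] + count (B n))      ≡⟨ cong₂ (λ xs ys → count xs + (count [ 1 ] + count ys))
                                                              (combine-1-0 (A (suc n)) (B (suc n)) (length-A≡length-B (suc n)))
                                                              (combine-0-1 (A n) (B n) (length-A≡length-B n)) ⟨
    N (suc n) 1 0 + (count [ 1 ] + N n 0 1)              ∎

module IntegerLinearAlgebra {X : Set} where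
  open import Data.Integer using (_+_; _*_; _-_; -_; _≟_)
  open import Data.Integer.Properties using (*-zeroʳ; +-identityˡ; +-assoc; i*j≡0⇒i≡0∨j≡0)
  open import Data.Integer.Tactic.RingSolver using (solve-∀)
  open import Data.List using (replicate; take; drop)
  open import Data.List.Properties using (length-replicate; length-take; take++drop≡id)
  open import Data.List.Relation.Unary.All using (All; []; _∷_)
  open import Data.List.Relation.Unary.Any using (Any; here; there)
  import Data.List.Relation.Unary.Any as Any
  import Data.List.Relation.Unary.Any.Properties as Any
  open import Data.Sum using (inj₁; inj₂; [_,_]′)

  combination : List ℤ → List (X → ℤ) → X → ℤ
  combination [] _ _ = 0ℤ
  combination (_ ∷ _) [] _ = 0ℤ
  combination (c ∷ cs) (v ∷ vs) x = c * v x + combination cs vs x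

  record VanishingCombination (xs : List X) (vs : List (X → ℤ)) : Set where
    field
      coefficients : List ℤ
      length-coefficients : length coefficients ≡ length vs
      nontrivial : Any (_≢ 0ℤ) coefficients
      vanishes : ∀ {x} → x ∈ xs → combination coefficients vs x ≡ 0ℤ

  combination-++ : ∀ cs ds us ws x → length cs ≡ length us →
    combination (cs ++ ds) (us ++ ws) x ≡ combination cs us x + combination ds ws x
  combination-++ [] ds [] ws x _ = sym (+-identityˡ _)
  combination-++ (c ∷ cs) ds (u ∷ us) ws x eq = begin
    c * u x + combination (cs ++ ds) (us ++ ws) x
      ≡⟨ cong (_+_ (c * u x)) (combination-++ cs ds us ws x (ℕ.suc-injective eq)) ⟩
    c * u x + (combination cs us x + combination ds ws x)
      ≡⟨ +-assoc (c * u x) _ _ ⟨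
    c * u x + combination cs us x + combination ds ws x
      ∎

  combination-scale : ∀ k cs vs x → combination (map (k *_) cs) vs x ≡ k * combination cs vs x
  combination-scale k [] vs x = sym (*-zeroʳ k)
  combination-scale k (c ∷ cs) [] x = sym (*-zeroʳ k)
  combination-scale k (c ∷ cs) (v ∷ vs) x = begin
    k * c * v x + combination (map (k *_) cs) vs x  ≡⟨ cong (_+_ (k * c * v x)) (combination-scale k cs vs x) ⟩
    k * c * v x + k * combination cs vs x           ≡⟨ distrib k c (v x) (combination cs vs x) ⟩
    k * (c * v x + combination cs vs x)             ∎
    where
    distrib : ∀ k c v s → k * c * v + k * s ≡ k * (c * v + s)
    distrib = solve-∀

  combination-vanishing : ∀ cs {vs} {x} → All (λ v → v x ≡ 0ℤ) vs → combination cs vs x ≡ 0ℤ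
  combination-vanishing [] _ = refl
  combination-vanishing (c ∷ cs) [] = refl
  combination-vanishing (c ∷ cs) (v≡0 ∷ vs≡0)
    rewrite v≡0 | combination-vanishing cs vs≡0 | *-zeroʳ c = refl

  eliminate : X → (X → ℤ) → (X → ℤ) → X → ℤ
  eliminate x₀ u w y = u x₀ * w y - w x₀ * u y

  private
    0≡i*0-0*j : ∀ i j → 0ℤ ≡ i * 0ℤ - 0ℤ * j
    0≡i*0-0*j = solve-∀

  combination-eliminate : ∀ x₀ u cs vs y →
    combination cs (map (eliminate x₀ u) vs) y ≡ u x₀ * combination cs vs y - combination cs vs x₀ * u y
  combination-eliminate x₀ u [] vs y = 0≡i*0-0*j (u x₀) (u y)
  combination-eliminate x₀ u (c ∷ cs) [] y = 0≡i*0-0*j (u x₀) (u y)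
  combination-eliminate x₀ u (c ∷ cs) (v ∷ vs) y
    rewrite combination-eliminate x₀ u cs vs y =
    step c (u x₀) (v y) (v x₀) (u y) (combination cs vs y) (combination cs vs x₀)
    where
    step : ∀ c p vy vx uy sy sx → c * (p * vy - vx * uy) + (p * sy - sx * uy) ≡ p * (c * vy + sy) - (c * vx + sx) * uy
    step = solve-∀

  combination-eliminate-pivot : ∀ x₀ u cs vs → combination cs (map (eliminate x₀ u) vs) x₀ ≡ 0ℤ
  combination-eliminate-pivot x₀ u cs vs =
    trans (combination-eliminate x₀ u cs vs x₀) (i*j-j*i≡0 (u x₀) (combination cs vs x₀))
    where
    i*j-j*i≡0 : ∀ i j → i * j - j * i ≡ 0ℤ
    i*j-j*i≡0 = solve-∀

  -- A relation among the vectors eliminate x₀ u w, with w ranging over us ++ ws, rewritten as a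
  -- relation among us ++ u ∷ ws.
  lift-coefficients : X → (X → ℤ) → List (X → ℤ) → List (X → ℤ) → List ℤ → List ℤ
  lift-coefficients x₀ u us ws βs =
    map (u x₀ *_) (take k βs) ++ - (combination (take k βs) us x₀ + combination (drop k βs) ws x₀) ∷ map (u x₀ *_) (drop k βs)
    where k = length us

  length-lift-coefficients : ∀ x₀ u us ws βs → length (lift-coefficients x₀ u us ws βs) ≡ suc (length βs)
  length-lift-coefficients x₀ u us ws βs = begin
    length (map (u x₀ *_) (take k βs) ++ _ ∷ map (u x₀ *_) (drop k βs))
      ≡⟨ length-++-∷ (map (u x₀ *_) (take k βs)) ⟩
    suc (length (map _ (take k βs)) ℕ.+ length (map _ (drop k βs)))
      ≡⟨ cong suc (cong₂ ℕ._+_ (length-map _ (take k βs)) (length-map _ (drop k βs))) ⟩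
    suc (length (take k βs) ℕ.+ length (drop k βs))
      ≡⟨ cong suc (length-++ (take k βs)) ⟨
    suc (length (take k βs ++ drop k βs))
      ≡⟨ cong (λ cs → suc (length cs)) (take++drop≡id k βs) ⟩
    suc (length βs)
      ∎
    where k = length us

  *-nonzero : ∀ {i j} → i ≢ 0ℤ → j ≢ 0ℤ → i * j ≢ 0ℤ
  *-nonzero {i} i≢0 j≢0 ij≡0 = [ i≢0 , j≢0 ]′ (i*j≡0⇒i≡0∨j≡0 i ij≡0)

  nontrivial-scale-insert : ∀ {p} γ βs δs → p ≢ 0ℤ →
    Any (_≢ 0ℤ) (βs ++ δs) → Any (_≢ 0ℤ) (map (p *_) βs ++ γ ∷ map (p *_) δs)
  nontrivial-scale-insert γ βs δs p≢0 nontrivial with Any.++⁻ βs nontrivial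
  ... | inj₁ βs≢0 = Any.++⁺ˡ (Any.map⁺ (Any.map (*-nonzero p≢0) βs≢0))
  ... | inj₂ δs≢0 = Any.++⁺ʳ (map _ βs) (there (Any.map⁺ (Any.map (*-nonzero p≢0) δs≢0)))

  nontrivial-lift-coefficients : ∀ x₀ u us ws βs → u x₀ ≢ 0ℤ →
    Any (_≢ 0ℤ) βs → Any (_≢ 0ℤ) (lift-coefficients x₀ u us ws βs)
  nontrivial-lift-coefficients x₀ u us ws βs p≢0 βs≢0 =
    nontrivial-scale-insert _ (take k βs) (drop k βs) p≢0 (subst (Any (_≢ 0ℤ)) (sym (take++drop≡id k βs)) βs≢0)
    where k = length us

  combination-lift-coefficients : ∀ x₀ u us ws βs → length us ≤ length βs → ∀ y →
    combination (lift-coefficients x₀ u us ws βs) (us ++ u ∷ ws) y ≡ combination βs (map (eliminate x₀ u) (us ++ ws)) y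
  combination-lift-coefficients x₀ u us ws βs us≤βs y = begin
    combination (map (p *_) β₁ ++ γ ∷ map (p *_) β₂) (us ++ u ∷ ws) y
      ≡⟨ combination-++ (map (p *_) β₁) _ us (u ∷ ws) y (trans (length-map _ β₁) length-β₁) ⟩
    combination (map (p *_) β₁) us y + (γ * u y + combination (map (p *_) β₂) ws y)
      ≡⟨ cong₂ (λ s t → s + (γ * u y + t)) (combination-scale p β₁ us y) (combination-scale p β₂ ws y) ⟩
    p * combination β₁ us y + (γ * u y + p * combination β₂ ws y)
      ≡⟨ rearrange p (combination β₁ us y) (combination β₂ ws y) (combination β₁ us x₀) (combination β₂ ws x₀) (u y) ⟩
    (p * combination β₁ us y - combination β₁ us x₀ * u y) + (p * combination β₂ ws y - combination β₂ ws x₀ * u y)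
      ≡⟨ cong₂ _+_ (combination-eliminate x₀ u β₁ us y) (combination-eliminate x₀ u β₂ ws y) ⟨
    combination β₁ (map (eliminate x₀ u) us) y + combination β₂ (map (eliminate x₀ u) ws) y
      ≡⟨ combination-++ β₁ β₂ (map (eliminate x₀ u) us) _ y (trans length-β₁ (sym (length-map _ us))) ⟨
    combination (β₁ ++ β₂) (map (eliminate x₀ u) us ++ map (eliminate x₀ u) ws) y
      ≡⟨ cong₂ (λ cs vs → combination cs vs y) (take++drop≡id k βs) (sym (map-++ (eliminate x₀ u) us ws)) ⟩
    combination βs (map (eliminate x₀ u) (us ++ ws)) y
      ∎
    where
    p = u x₀
    k = length us
    β₁ = take k βs
    β₂ = drop k βs
    γ = - (combination β₁ us x₀ + combination β₂ ws x₀)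
    length-β₁ : length β₁ ≡ k
    length-β₁ = trans (length-take k βs) (ℕ.m≤n⇒m⊓n≡m us≤βs)
    rearrange : ∀ p s t s₀ t₀ v → p * s + (- (s₀ + t₀) * v + p * t) ≡ (p * s - s₀ * v) + (p * t - t₀ * v)
    rearrange = solve-∀

  data Pivot (x₀ : X) : List (X → ℤ) → Set where
    no-pivot : ∀ {vs} → All (λ v → v x₀ ≡ 0ℤ) vs → Pivot x₀ vs
    pivot : ∀ us u ws → u x₀ ≢ 0ℤ → Pivot x₀ (us ++ u ∷ ws)

  pivot? : ∀ x₀ vs → Pivot x₀ vs
  pivot? x₀ [] = no-pivot []
  pivot? x₀ (v ∷ vs) with v x₀ ≟ 0ℤ
  ... | no v≢0 = pivot [] v vs v≢0
  ... | yes v≡0 with pivot? x₀ vs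
  ...   | no-pivot vs≡0 = no-pivot (v≡0 ∷ vs≡0)
  ...   | pivot us u ws u≢0 = pivot (v ∷ us) u ws u≢0

  extend-by-zero-row : ∀ {x₀ xs vs} → All (λ v → v x₀ ≡ 0ℤ) vs →
    VanishingCombination xs vs → VanishingCombination (x₀ ∷ xs) vs
  extend-by-zero-row vs≡0 r = record
    { coefficients = coefficients
    ; length-coefficients = length-coefficients
    ; nontrivial = nontrivial
    ; vanishes = λ { (here refl) → combination-vanishing coefficients vs≡0 ; (there x∈xs) → vanishes x∈xs }
    }
    where open VanishingCombination r

  lift-through-pivot : ∀ {x₀ xs} us u ws → u x₀ ≢ 0ℤ →
    VanishingCombination xs (map (eliminate x₀ u) (us ++ ws)) →
    VanishingCombination (x₀ ∷ xs) (us ++ u ∷ ws)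
  lift-through-pivot {x₀} us u ws u≢0 r = record
    { coefficients = lift-coefficients x₀ u us ws coefficients
    ; length-coefficients = begin
        length (lift-coefficients x₀ u us ws coefficients)  ≡⟨ length-lift-coefficients x₀ u us ws coefficients ⟩
        suc (length coefficients)                           ≡⟨ cong suc length-βs ⟩
        suc (length us ℕ.+ length ws)                       ≡⟨ length-++-∷ us ⟨
        length (us ++ u ∷ ws)                               ∎
    ; nontrivial = nontrivial-lift-coefficients x₀ u us ws coefficients u≢0 nontrivial
    ; vanishes = λ
        { (here refl) → trans (lifted x₀) (combination-eliminate-pivot x₀ u coefficients (us ++ ws))
        ; (there x∈xs) → trans (lifted _) (vanishes x∈xs)
        }
    }
    where
    open VanishingCombination r
    length-βs : length coefficients ≡ length us ℕ.+ length ws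
    length-βs = trans length-coefficients (trans (length-map _ (us ++ ws)) (length-++ us))
    lifted = combination-lift-coefficients x₀ u us ws coefficients (subst (length us ≤_) (sym length-βs) (ℕ.m≤m+n _ _))

  vanishing-combination : ∀ xs vs → length xs < length vs → VanishingCombination xs vs
  vanishing-combination [] (v ∷ vs) _ = record
    { coefficients = 1ℤ ∷ replicate (length vs) 0ℤ
    ; length-coefficients = cong suc (length-replicate (length vs))
    ; nontrivial = here (λ ())
    ; vanishes = λ ()
    }
  vanishing-combination (x₀ ∷ xs) vs xs<vs with pivot? x₀ vs
  ... | no-pivot vs≡0 = extend-by-zero-row vs≡0 (vanishing-combination xs vs (ℕ.<-trans (ℕ.n<1+n _) xs<vs))
  ... | pivot us u ws u≢0 =
    lift-through-pivot us u ws u≢0 (vanishing-combination xs (map (eliminate x₀ u) (us ++ ws)) fewer-rows)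
    where
    fewer-rows : length xs < length (map (eliminate x₀ u) (us ++ ws))
    fewer-rows = subst (length xs <_) (sym (trans (length-map _ (us ++ ws)) (length-++ us)))
                   (ℕ.s<s⁻¹ (subst (suc (length xs) <_) (length-++-∷ us) xs<vs))

module LinearRecurrence where
  open import Data.Integer using (_+_; _*_)
  open import Data.Integer.Properties using (+-identityˡ; +-identityʳ; +-assoc; +-comm; *-zeroʳ)
  open import Data.Integer.Tactic.RingSolver using (solve-∀)
  open import Data.List using (reverse)
  open import Data.List.Properties using (unfold-reverse; length-reverse)
  import Data.List.Relation.Unary.Any.Properties as Any

  shifted-sum : List ℤ → (ℕ → ℤ) → ℕ → ℤ
  shifted-sum [] _ _ = 0ℤ
  shifted-sum (c ∷ cs) s n = c * s n + shifted-sum cs s (suc n)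

  mulCoeff-++ : ∀ xs ys s j → mulCoeff (xs ++ ys) s (length xs ℕ.+ j) ≡ mulCoeff xs s (length xs ℕ.+ j) + mulCoeff ys s j
  mulCoeff-++ [] ys s j = sym (+-identityˡ _)
  mulCoeff-++ (x ∷ xs) ys s j rewrite mulCoeff-++ xs ys s j = sym (+-assoc (x * s (suc (length xs ℕ.+ j))) _ _)

  mulCoeff-reverse : ∀ cs s n → mulCoeff (reverse cs) s (length cs ℕ.+ n) ≡ shifted-sum cs s (suc n)
  mulCoeff-reverse [] s n = refl
  mulCoeff-reverse (c ∷ cs) s n = begin
    mulCoeff (reverse (c ∷ cs)) s (suc (length cs ℕ.+ n))
      ≡⟨ cong₂ (λ qs i → mulCoeff qs s i) (unfold-reverse c cs)
           (trans (sym (ℕ.+-suc (length cs) n)) (cong (ℕ._+ suc n) (sym (length-reverse cs)))) ⟩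
    mulCoeff (reverse cs ++ [ c ]) s (length (reverse cs) ℕ.+ suc n)
      ≡⟨ mulCoeff-++ (reverse cs) [ c ] s (suc n) ⟩
    mulCoeff (reverse cs) s (length (reverse cs) ℕ.+ suc n) + (c * s (suc n) + 0ℤ)
      ≡⟨ cong₂ _+_ (cong (λ k → mulCoeff (reverse cs) s (k ℕ.+ suc n)) (length-reverse cs)) (+-identityʳ _) ⟩
    mulCoeff (reverse cs) s (length cs ℕ.+ suc n) + c * s (suc n)
      ≡⟨ cong (_+ c * s (suc n)) (mulCoeff-reverse cs s (suc n)) ⟩
    shifted-sum cs s (suc (suc n)) + c * s (suc n)
      ≡⟨ +-comm (shifted-sum cs s (suc (suc n))) _ ⟩
    c * s (suc n) + shifted-sum cs s (suc (suc n))
      ∎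

  LinearForm : Set → Set
  LinearForm X = List (ℤ × X)

  module _ {X : Set} where

    evaluate : LinearForm X → (X → ℤ) → ℤ
    evaluate [] _ = 0ℤ
    evaluate ((k , y) ∷ f) u = k * u y + evaluate f u

    evaluate-zero : ∀ f → evaluate f (λ _ → 0ℤ) ≡ 0ℤ
    evaluate-zero [] = refl
    evaluate-zero ((k , y) ∷ f) rewrite evaluate-zero f | *-zeroʳ k = refl

    evaluate-cong : ∀ f {u w} → (∀ y → u y ≡ w y) → evaluate f u ≡ evaluate f w
    evaluate-cong [] _ = refl
    evaluate-cong ((k , y) ∷ f) u≗w = cong₂ (λ a b → k * a + b) (u≗w y) (evaluate-cong f u≗w)

    evaluate-linear : ∀ f c u w → evaluate f (λ y → c * u y + w y) ≡ c * evaluate f u + evaluate f w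
    evaluate-linear [] c u w = sym (cong (_+ 0ℤ) (*-zeroʳ c))
    evaluate-linear ((k , y) ∷ f) c u w rewrite evaluate-linear f c u w =
      distrib k c (u y) (w y) (evaluate f u) (evaluate f w)
      where
      distrib : ∀ k c u w U W → k * (c * u + w) + (c * U + W) ≡ c * (k * u + U) + (k * w + W)
      distrib = solve-∀

  module Orbit {X : Set} (xs : List X) (complete : ∀ x → x ∈ xs)
    (M : X → LinearForm X) (v : ℕ → X → ℤ) (v-suc : ∀ n x → v (suc n) x ≡ evaluate (M x) (v n)) where

    open IntegerLinearAlgebra {X}

    window : ℕ → ℕ → List (X → ℤ)
    window _ zero = []
    window n (suc k) = v n ∷ window (suc n) k

    length-window : ∀ n k → length (window n k) ≡ k
    length-window n zero = refl
    length-window n (suc k) = cong suc (length-window (suc n) k)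

    combination-window-suc : ∀ cs n k x →
      combination cs (window (suc n) k) x ≡ evaluate (M x) (combination cs (window n k))
    combination-window-suc [] n k x = sym (evaluate-zero (M x))
    combination-window-suc (c ∷ cs) n zero x = sym (evaluate-zero (M x))
    combination-window-suc (c ∷ cs) n (suc k) x = begin
      c * v (suc n) x + combination cs (window (suc (suc n)) k) x
        ≡⟨ cong₂ (λ a b → c * a + b) (v-suc n x) (combination-window-suc cs (suc n) k x) ⟩
      c * evaluate (M x) (v n) + evaluate (M x) (combination cs (window (suc n) k))
        ≡⟨ evaluate-linear (M x) c (v n) (combination cs (window (suc n) k)) ⟨
      evaluate (M x) (combination (c ∷ cs) (window n (suc k)))
        ∎

    vanishing-window : ∀ cs k → (∀ x → combination cs (window 0 k) x ≡ 0ℤ) → ∀ n x → combination cs (window n k) x ≡ 0ℤ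
    vanishing-window cs k vanishes₀ zero x = vanishes₀ x
    vanishing-window cs k vanishes₀ (suc n) x = begin
      combination cs (window (suc n) k) x           ≡⟨ combination-window-suc cs n k x ⟩
      evaluate (M x) (combination cs (window n k))  ≡⟨ evaluate-cong (M x) (vanishing-window cs k vanishes₀ n) ⟩
      evaluate (M x) (λ _ → 0ℤ)                      ≡⟨ evaluate-zero (M x) ⟩
      0ℤ                                             ∎

    module _ (φ : LinearForm X) (s : ℕ → ℤ) (s≡φv : ∀ n → s n ≡ evaluate φ (v n)) where

      shifted-sum-window : ∀ cs n k → length cs ≡ k → shifted-sum cs s n ≡ evaluate φ (combination cs (window n k))
      shifted-sum-window [] n _ _ = sym (evaluate-zero φ)
      shifted-sum-window (c ∷ cs) n (suc k) eq = begin
        c * s n + shifted-sum cs s (suc n)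
          ≡⟨ cong₂ (λ a b → c * a + b) (s≡φv n) (shifted-sum-window cs (suc n) k (ℕ.suc-injective eq)) ⟩
        c * evaluate φ (v n) + evaluate φ (combination cs (window (suc n) k))
          ≡⟨ evaluate-linear φ c (v n) (combination cs (window (suc n) k)) ⟨
        evaluate φ (combination (c ∷ cs) (window n (suc k)))
          ∎

      -- A vanishing combination of the first |X| + 1 states vanishes on every window of the orbit;
      -- reversed, its coefficients are the denominator.
      rational : IsRationalSeries s
      rational = reverse coefficients , Any.reverse⁺ nontrivial , length coefficients , eventually-zero
        where
        K = suc (length xs)
        open VanishingCombination (vanishing-combination xs (window 0 K) (subst (length xs <_) (sym (length-window 0 K)) (ℕ.n<1+n _)))
        eventually-zero : ∀ n → length coefficients ≤ n → mulCoeff (reverse coefficients) s n ≡ 0ℤ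
        eventually-zero n N≤n with ℕ.m≤n⇒∃[o]m+o≡n N≤n
        ... | k , refl = begin
          mulCoeff (reverse coefficients) s (length coefficients ℕ.+ k)
            ≡⟨ mulCoeff-reverse coefficients s k ⟩
          shifted-sum coefficients s (suc k)
            ≡⟨ shifted-sum-window coefficients (suc k) K (trans length-coefficients (length-window 0 K)) ⟩
          evaluate φ (combination coefficients (window (suc k) K))
            ≡⟨ evaluate-cong φ (vanishing-window coefficients K (λ x → vanishes (complete x)) (suc k)) ⟩
          evaluate φ (λ _ → 0ℤ)
            ≡⟨ evaluate-zero φ ⟩
          0ℤ
            ∎

module ResidueStates (m : ℕ) .{{_ : NonZero m}} (a : ℕ) where
  open ResidueCount m a
  open LinearRecurrence
  open import Data.Nat.DivMod using (_%_; _mod_; m%n<n; m%n%n≡m%n)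
  open import Data.Integer as ℤ using ()
  open import Data.Integer.Properties using (pos-+)
  open import Data.Integer.Tactic.RingSolver using (solve-∀)
  open import Data.Fin using (Fin; zero; suc; toℕ; #_)
  open import Data.Fin.Properties using (toℕ-fromℕ<)
  open import Data.List using (allFin; cartesianProduct)
  open import Data.List.Membership.Propositional.Properties using (∈-cartesianProduct⁺; ∈-allFin)

  -- (k, α, β) stands for N_{j+k}(α, β) when k < 3, and for the constant 1 when k = 3.
  Coordinate : Set
  Coordinate = Fin 4 × Fin m × Fin m

  coordinates : List Coordinate
  coordinates = cartesianProduct (allFin 4) (cartesianProduct (allFin m) (allFin m))

  ∈-coordinates : ∀ x → x ∈ coordinates
  ∈-coordinates (k , α , β) = ∈-cartesianProduct⁺ (∈-allFin k) (∈-cartesianProduct⁺ (∈-allFin α) (∈-allFin β))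

  toℕ-mod : ∀ x → toℕ (x mod m) ≡ₘ x
  toℕ-mod x = trans (cong (_% m) (toℕ-fromℕ< (m%n<n x m))) (m%n%n≡m%n x m)

  private
    i≡1*i+0 : ∀ i → i ≡ 1ℤ ℤ.* i ℤ.+ 0ℤ
    i≡1*i+0 = solve-∀

  state : ℕ → Coordinate → ℤ
  state j (zero , α , β) = + N j (toℕ α) (toℕ β)
  state j (suc zero , α , β) = + N (1 ℕ.+ j) (toℕ α) (toℕ β)
  state j (suc (suc zero) , α , β) = + N (2 ℕ.+ j) (toℕ α) (toℕ β)
  state j (suc (suc (suc _)) , _) = 1ℤ

  _⊞_ : Fin m → Fin m → Fin m
  α ⊞ β = (toℕ α ℕ.+ toℕ β) mod m

  transition : Coordinate → LinearForm Coordinate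
  transition (zero , x) = [ 1ℤ , (# 1 , x) ]
  transition (suc zero , x) = [ 1ℤ , (# 2 , x) ]
  transition (suc (suc zero) , α , β) =
    (1ℤ , (# 1 , α ⊞ β , β)) ∷ (1ℤ , (# 0 , α ⊞ β , α ⊞ β)) ∷ (1ℤ , (# 1 , α , α ⊞ β)) ∷
    (+ (s ℕ.+ s) , (# 3 , α , β)) ∷ []
    where s = count [ toℕ α ℕ.* 1 ℕ.+ toℕ β ℕ.* 1 ]
  transition x@(suc (suc (suc _)) , _) = [ 1ℤ , x ]

  state-suc : ∀ j x → state (suc j) x ≡ evaluate (transition x) (state j)
  state-suc j (zero , _) = i≡1*i+0 _
  state-suc j (suc zero , _) = i≡1*i+0 _
  state-suc j (suc (suc zero) , α , β) = begin
    + N (3 ℕ.+ j) α′ β′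
      ≡⟨ cong +_ (N-recurrence j α′ β′) ⟩
    + (N (suc j) (α′ ℕ.+ β′) β′ ℕ.+ N j (α′ ℕ.+ β′) (α′ ℕ.+ β′) ℕ.+ N (suc j) α′ (α′ ℕ.+ β′) ℕ.+ (s ℕ.+ s))
      ≡⟨ cong₂ (λ p q → + (p ℕ.+ q ℕ.+ (s ℕ.+ s)))
           (cong₂ ℕ._+_ (N-congₘ (suc j) {β = β′} σ≡ refl) (N-congₘ j σ≡ σ≡)) (N-congₘ (suc j) {α = α′} refl σ≡) ⟩
    + (N (suc j) σ β′ ℕ.+ N j σ σ ℕ.+ N (suc j) α′ σ ℕ.+ (s ℕ.+ s))
      ≡⟨ pos-sum (N (suc j) σ β′) (N j σ σ) (N (suc j) α′ σ) (s ℕ.+ s) ⟩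
    evaluate (transition (# 2 , α , β)) (state j)
      ∎
    where
    α′ = toℕ α
    β′ = toℕ β
    σ = toℕ (α ⊞ β)
    s = count [ α′ ℕ.* 1 ℕ.+ β′ ℕ.* 1 ]
    σ≡ : α′ ℕ.+ β′ ≡ₘ σ
    σ≡ = sym (toℕ-mod (α′ ℕ.+ β′))
    pos-sum : ∀ p q r t →
      + (p ℕ.+ q ℕ.+ r ℕ.+ t) ≡ 1ℤ ℤ.* + p ℤ.+ (1ℤ ℤ.* + q ℤ.+ (1ℤ ℤ.* + r ℤ.+ (+ t ℤ.* 1ℤ ℤ.+ 0ℤ)))
    pos-sum p q r t = begin
      + (p ℕ.+ q ℕ.+ r ℕ.+ t)      ≡⟨ pos-+ (p ℕ.+ q ℕ.+ r) t ⟩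
      + (p ℕ.+ q ℕ.+ r) ℤ.+ + t    ≡⟨ cong (ℤ._+ + t) (trans (pos-+ (p ℕ.+ q) r) (cong (ℤ._+ + r) (pos-+ p q))) ⟩
      + p ℤ.+ + q ℤ.+ + r ℤ.+ + t  ≡⟨ normalise (+ p) (+ q) (+ r) (+ t) ⟩
      _                            ∎
      where
      normalise : ∀ p q r t →
        p ℤ.+ q ℤ.+ r ℤ.+ t ≡ 1ℤ ℤ.* p ℤ.+ (1ℤ ℤ.* q ℤ.+ (1ℤ ℤ.* r ℤ.+ (t ℤ.* 1ℤ ℤ.+ 0ℤ)))
      normalise = solve-∀
  state-suc j (suc (suc (suc _)) , _) = i≡1*i+0 _

  h-form : LinearForm Coordinate
  h-form = (1ℤ , (# 1 , 1 mod m , 0 mod m)) ∷ (+ count [ 1 ] , (# 3 , 0 mod m , 0 mod m)) ∷ (1ℤ , (# 0 , 0 mod m , 1 mod m)) ∷ []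

  h≡h-form : ∀ n → + h m a n ≡ evaluate h-form (state n)
  h≡h-form n = begin
    + h m a n
      ≡⟨ cong +_ (h≡N n) ⟩
    + (N (suc n) 1 0 ℕ.+ (count [ 1 ] ℕ.+ N n 0 1))
      ≡⟨ cong₂ (λ p q → + (p ℕ.+ (count [ 1 ] ℕ.+ q)))
           (N-congₘ (suc n) (sym (toℕ-mod 1)) (sym (toℕ-mod 0))) (N-congₘ n (sym (toℕ-mod 0)) (sym (toℕ-mod 1))) ⟩
    + (N (suc n) (toℕ (1 mod m)) (toℕ (0 mod m)) ℕ.+ (count [ 1 ] ℕ.+ N n (toℕ (0 mod m)) (toℕ (1 mod m))))
      ≡⟨ pos-sum (N (suc n) (toℕ (1 mod m)) (toℕ (0 mod m))) (count [ 1 ]) (N n (toℕ (0 mod m)) (toℕ (1 mod m))) ⟩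
    evaluate h-form (state n)
      ∎
    where
    pos-sum : ∀ p c q → + (p ℕ.+ (c ℕ.+ q)) ≡ 1ℤ ℤ.* + p ℤ.+ (+ c ℤ.* 1ℤ ℤ.+ (1ℤ ℤ.* + q ℤ.+ 0ℤ))
    pos-sum p c q = begin
      + (p ℕ.+ (c ℕ.+ q))        ≡⟨ trans (pos-+ p (c ℕ.+ q)) (cong (ℤ._+_ (+ p)) (pos-+ c q)) ⟩
      + p ℤ.+ (+ c ℤ.+ + q)      ≡⟨ normalise (+ p) (+ c) (+ q) ⟩
      _                          ∎
      where
      normalise : ∀ p c q → p ℤ.+ (c ℤ.+ q) ≡ 1ℤ ℤ.* p ℤ.+ (c ℤ.* 1ℤ ℤ.+ (1ℤ ℤ.* q ℤ.+ 0ℤ))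
      normalise = solve-∀

theorem8 : (m : ℕ) → .{{_ : NonZero m}} → (a : ℕ) → a < m →
    IsRationalSeries (λ n → + h m a n)
theorem8 m a _ = LinearRecurrence.Orbit.rational coordinates ∈-coordinates transition state state-suc
                   h-form (λ n → + h m a n) h≡h-form
  where open ResidueStates m a
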